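{- Let $m,n\geq1$, $x,y\in P(T,m\times n)$ and $i,j\in\{1,2\}$. Then $\mu(x)[i,j,m\times n]=\mu(y)[i,j,m\times n]$ if and only if $\phi(x)[i,j,m\times n]=\phi(y)[i,j,m\times n]$.
   Context: Let $\mathcal{A}=\{\mathtt{A},\dots,\mathtt{P}\}$, $\mathcal{B}=\{\mathtt{0},\mathtt{1},\mathtt{2},\mathtt{3}\}$. The substitution $\mu$ maps each letter to a $2\times2$ block over $\mathcal{A}$ (written (first row / second row)): $\mathtt{A}\mapsto(\mathtt{AF}/\mathtt{GC})$, $\mathtt{B}\mapsto(\mathtt{AF}/\mathtt{HD})$, $\mathtt{C}\mapsto(\mathtt{BE}/\mathtt{GC})$, $\mathtt{D}\mapsto(\mathtt{BE}/\mathtt{HD})$, $\mathtt{E}\mapsto(\mathtt{AN}/\mathtt{GK})$, $\mathtt{F}\mapsto(\mathtt{AN}/\mathtt{HL})$, $\mathtt{G}\mapsto(\mathtt{BM}/\mathtt{GK})$, $\mathtt{H}\mapsto(\mathtt{BM}/\mathtt{HL})$, $\mathtt{I}\mapsto(\mathtt{IF}/\mathtt{OC})$, $\mathtt{J}\mapsto(\mathtt{IF}/\mathtt{PD})$, $\mathtt{K}\mapsto(\mathtt{JE}/\mathtt{OC})$, $\mathtt{L}\mapsto(\mathtt{JE}/\mathtt{PD})$, $\mathtt{M}\mapsto(\mathtt{IN}/\mathtt{OK})$, $\mathtt{N}\mapsto(\mathtt{IN}/\mathtt{PL})$, $\mathtt{O}\mapsto(\mathtt{JM}/\mathtt{OK})$,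 $\mathtt{P}\mapsto(\mathtt{JM}/\mathtt{PL})$. The map $\phi$ from $\mathcal{A}$ to $2\times2$ blocks over $\mathcal{B}$: $\mathtt{A}\mapsto(01/00)$, $\mathtt{B}\mapsto(01/11)$, $\mathtt{C}\mapsto(10/00)$, $\mathtt{D}\mapsto(10/11)$, $\mathtt{E}\mapsto(03/02)$, $\mathtt{F}\mapsto(03/13)$, $\mathtt{G}\mapsto(12/02)$, $\mathtt{H}\mapsto(12/13)$, $\mathtt{I}\mapsto(21/20)$, $\mathtt{J}\mapsto(21/31)$, $\mathtt{K}\mapsto(30/20)$, $\mathtt{L}\mapsto(30/31)$, $\mathtt{M}\mapsto(23/22)$, $\mathtt{N}\mapsto(23/33)$, $\mathtt{O}\mapsto(32/22)$, $\mathtt{P}\mapsto(32/33)$. For an $m\times n$ matrix $X$ over $\mathcal{A}$, $\mu(X)$ and $\phi(X)$ are the $2m\times2n$ matrices obtained by replacing each entry by its block; $\mu^0=\mathrm{id}$, $\mu^k=\mu^{k-1}\circ\mu$; $T_k:=\mu^k(\mathtt{N})$. For a matrix $X$, $X[r,c,m\times n]$ is its $m\times n$ contiguous submatrix with upper-left corner at row $r$, column $c$; $P(X,m\times n)$ is the set of all its $m\times n$ contiguous submatrices, and $P(T,m\times n):=\bigcup_{k\ge0}P(T_k,m\times n)$. -}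

module Defs where

open import Data.Nat using (ℕ; zero; suc; _+_; _*_; _∸_; _^_; _≤_; _<_)
open import Data.Nat.DivMod using (_/_; _%_)
open import Data.Product using (∃; _×_; _,_)
open import Relation.Binary.PropositionalEquality using (_≡_)

data 𝒜 : Set where
  A B C D E F G H I J K L M N O P : 𝒜

data ℬ : Set where
  b0 b1 b2 b3 : ℬ

-- Matrices are represented as functions ℕ → ℕ → X of (0-based) row and
-- column index; an m×n matrix is such a function of which only the entries
-- with row < m and column < n are relevant (all notions below only ever
-- inspect those entries).
Mat : Set → Set
Mat X = ℕ → ℕ → X

pick : {X : Set} → X → X → X → X → ℕ → ℕ → X
pick p q r s zero    zero    = p
pick p q r s zero    (suc _) = q
pick p q r s (suc _) zero    = r
pick p q r s (suc _) (suc _) = s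

μ-blk : 𝒜 → ℕ → ℕ → 𝒜
μ-blk A = pick A F G C
μ-blk B = pick A F H D
μ-blk C = pick B E G C
μ-blk D = pick B E H D
μ-blk E = pick A N G K
μ-blk F = pick A N H L
μ-blk G = pick B M G K
μ-blk H = pick B M H L
μ-blk I = pick I F O C
μ-blk J = pick I F P D
μ-blk K = pick J E O C
μ-blk L = pick J E P D
μ-blk M = pick I N O K
μ-blk N = pick I N P L
μ-blk O = pick J M O K
μ-blk P = pick J M P L

φ-blk : 𝒜 → ℕ → ℕ → ℬ
φ-blk A = pick b0 b1 b0 b0
φ-blk B = pick b0 b1 b1 b1
φ-blk C = pick b1 b0 b0 b0
φ-blk D = pick b1 b0 b1 b1
φ-blk E = pick b0 b3 b0 b2
φ-blk F = pick b0 b3 b1 b3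
φ-blk G = pick b1 b2 b0 b2
φ-blk H = pick b1 b2 b1 b3
φ-blk I = pick b2 b1 b2 b0
φ-blk J = pick b2 b1 b3 b1
φ-blk K = pick b3 b0 b2 b0
φ-blk L = pick b3 b0 b3 b1
φ-blk M = pick b2 b3 b2 b2
φ-blk N = pick b2 b3 b3 b3
φ-blk O = pick b3 b2 b2 b2
φ-blk P = pick b3 b2 b3 b3

μ : Mat 𝒜 → Mat 𝒜
μ X a b = μ-blk (X (a / 2) (b / 2)) (a % 2) (b % 2)

φ : Mat 𝒜 → Mat ℬ
φ X a b = φ-blk (X (a / 2) (b / 2)) (a % 2) (b % 2)

μ^ : ℕ → Mat 𝒜 → Mat 𝒜
μ^ zero    X = X
μ^ (suc k) X = μ^ k (μ X)

-- T_k = μ^k(N), a 2^k × 2^k matrix (the 1×1 matrix N is the constant function).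
T : ℕ → Mat 𝒜
T k = μ^ k (λ _ _ → N)

-- Equality of the m×n submatrices X[r,c,m×n] and Y[r,c,m×n], with the
-- paper's 1-based upper-left corner (r,c).
SubEq : {X : Set} → Mat X → Mat X → ℕ → ℕ → ℕ → ℕ → Set
SubEq U V r c m n =
  ∀ a b → a < m → b < n → U (r ∸ 1 + a) (c ∸ 1 + b) ≡ V (r ∸ 1 + a) (c ∸ 1 + b)

-- x ∈ P(T_k, m×n): the m×n matrix x equals T_k[r,c,m×n] for some
-- 0-based corner (r,c) with the window inside the 2^k × 2^k matrix T_k.
InP-Tk : ℕ → Mat 𝒜 → ℕ → ℕ → Set
InP-Tk k x m n = ∃ λ r → ∃ λ c → (r + m ≤ 2 ^ k) × (c + n ≤ 2 ^ k) ×
  (∀ a b → a < m → b < n → x a b ≡ T k (r + a) (c + b))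

InP-T : Mat 𝒜 → ℕ → ℕ → Set
InP-T x m n = ∃ λ k → InP-Tk k x m n

{-# OPTIONS --safe #-}
-- φ factors through μ: every block φ(ℓ) is obtained from μ(ℓ) by the letter-to-letter coding
-- `code`, so μ(x) determines φ(x) entrywise.  Conversely, at each of the four positions of a
-- 2×2 block only four letters ever occur in an image μ(ℓ) (A,B,I,J at the upper left, …), and
-- `code` separates them; so φ(x) together with the parity of the position determines μ(x).
-- Hence the two windows agree simultaneously, for arbitrary matrices x and y.
module Submission where

open import Defs
open import Data.Nat using (ℕ; _≤_; zero; suc; _/_; _%_)
open import Function.Bundles using (_⇔_; mk⇔; Equivalence)
open import Relation.Binary.PropositionalEquality using (_≡_; refl; sym; cong; module ≡-Reasoning)

pick-map : {X Y : Set} (f : X → Y) {p q r s : X} (a b : ℕ) →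
           f (pick p q r s a b) ≡ pick (f p) (f q) (f r) (f s) a b
pick-map f zero    zero    = refl
pick-map f zero    (suc _) = refl
pick-map f (suc _) zero    = refl
pick-map f (suc _) (suc _) = refl

pick-ap : {X Y : Set} {f g h k : X → Y} {p q r s : X} (a b : ℕ) →
          pick f g h k a b (pick p q r s a b) ≡ pick (f p) (g q) (h r) (k s) a b
pick-ap zero    zero    = refl
pick-ap zero    (suc _) = refl
pick-ap (suc _) zero    = refl
pick-ap (suc _) (suc _) = refl

code : 𝒜 → ℬ
code A = b0
code B = b1
code C = b0
code D = b1
code E = b0
code F = b1
code G = b0
code H = b1
code I = b2
code J = b3
code K = b2
code L = b3
code M = b2
code N = b3
code O = b2
code P = b3

decode : ℕ → ℕ → ℬ → 𝒜
decode = pick (λ { b0 → A ; b1 → B ; b2 → I ; b3 → J })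
              (λ { b0 → E ; b1 → F ; b2 → M ; b3 → N })
              (λ { b0 → G ; b1 → H ; b2 → O ; b3 → P })
              (λ { b0 → C ; b1 → D ; b2 → K ; b3 → L })

φ-blk≡code∘μ-blk : ∀ ℓ a b → φ-blk ℓ a b ≡ code (μ-blk ℓ a b)
φ-blk≡code∘μ-blk A a b = sym (pick-map code a b)
φ-blk≡code∘μ-blk B a b = sym (pick-map code a b)
φ-blk≡code∘μ-blk C a b = sym (pick-map code a b)
φ-blk≡code∘μ-blk D a b = sym (pick-map code a b)
φ-blk≡code∘μ-blk E a b = sym (pick-map code a b)
φ-blk≡code∘μ-blk F a b = sym (pick-map code a b)
φ-blk≡code∘μ-blk G a b = sym (pick-map code a b)
φ-blk≡code∘μ-blk H a b = sym (pick-map code a b)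
φ-blk≡code∘μ-blk I a b = sym (pick-map code a b)
φ-blk≡code∘μ-blk J a b = sym (pick-map code a b)
φ-blk≡code∘μ-blk K a b = sym (pick-map code a b)
φ-blk≡code∘μ-blk L a b = sym (pick-map code a b)
φ-blk≡code∘μ-blk M a b = sym (pick-map code a b)
φ-blk≡code∘μ-blk N a b = sym (pick-map code a b)
φ-blk≡code∘μ-blk O a b = sym (pick-map code a b)
φ-blk≡code∘μ-blk P a b = sym (pick-map code a b)

decode∘φ-blk : ∀ ℓ a b → decode a b (φ-blk ℓ a b) ≡ μ-blk ℓ a b
decode∘φ-blk A a b = pick-ap a b
decode∘φ-blk B a b = pick-ap a b
decode∘φ-blk C a b = pick-ap a b
decode∘φ-blk D a b = pick-ap a b
decode∘φ-blk E a b = pick-ap a b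
decode∘φ-blk F a b = pick-ap a b
decode∘φ-blk G a b = pick-ap a b
decode∘φ-blk H a b = pick-ap a b
decode∘φ-blk I a b = pick-ap a b
decode∘φ-blk J a b = pick-ap a b
decode∘φ-blk K a b = pick-ap a b
decode∘φ-blk L a b = pick-ap a b
decode∘φ-blk M a b = pick-ap a b
decode∘φ-blk N a b = pick-ap a b
decode∘φ-blk O a b = pick-ap a b
decode∘φ-blk P a b = pick-ap a b

φ≡code∘μ : ∀ X a b → φ X a b ≡ code (μ X a b)
φ≡code∘μ X a b = φ-blk≡code∘μ-blk (X (a / 2) (b / 2)) (a % 2) (b % 2)

decode∘φ : ∀ X a b → decode (a % 2) (b % 2) (φ X a b) ≡ μ X a b
decode∘φ X a b = decode∘φ-blk (X (a / 2) (b / 2)) (a % 2) (b % 2)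

μ-≡⇔φ-≡ : ∀ X Y a b → μ X a b ≡ μ Y a b ⇔ φ X a b ≡ φ Y a b
μ-≡⇔φ-≡ X Y a b = mk⇔ to from
  where
  open ≡-Reasoning
  to : μ X a b ≡ μ Y a b → φ X a b ≡ φ Y a b
  to μ≡ = begin
    φ X a b         ≡⟨ φ≡code∘μ X a b ⟩
    code (μ X a b)  ≡⟨ cong code μ≡ ⟩
    code (μ Y a b)  ≡⟨ φ≡code∘μ Y a b ⟨
    φ Y a b         ∎
  from : φ X a b ≡ φ Y a b → μ X a b ≡ μ Y a b
  from φ≡ = begin
    μ X a b                             ≡⟨ decode∘φ X a b ⟨
    decode (a % 2) (b % 2) (φ X a b)    ≡⟨ cong (decode (a % 2) (b % 2)) φ≡ ⟩
    decode (a % 2) (b % 2) (φ Y a b)    ≡⟨ decode∘φ Y a b ⟩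
    μ Y a b                             ∎

SubEq-cong : {X Y : Set} {U V : Mat X} {U′ V′ : Mat Y} →
             (∀ a b → U a b ≡ V a b ⇔ U′ a b ≡ V′ a b) →
             ∀ r c m n → SubEq U V r c m n ⇔ SubEq U′ V′ r c m n
SubEq-cong U⇔U′ r c m n = mk⇔
  (λ eq a b a<m b<n → Equivalence.to   (U⇔U′ _ _) (eq a b a<m b<n))
  (λ eq a b a<m b<n → Equivalence.from (U⇔U′ _ _) (eq a b a<m b<n))

lemma5 : (m n : ℕ) → 1 ≤ m → 1 ≤ n → (x y : Mat 𝒜) → InP-T x m n → InP-T y m n →
    (i j : ℕ) → 1 ≤ i → i ≤ 2 → 1 ≤ j → j ≤ 2 →
    (SubEq (μ x) (μ y) i j m n ⇔ SubEq (φ x) (φ y) i j m n)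
lemma5 m n _ _ x y _ _ i j _ _ _ _ = SubEq-cong (μ-≡⇔φ-≡ x y) i j m n
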